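{- $\mathsf{QC2}$ is not the logic of any class of selection frames; that is, there is no class $\mathcal{C}$ of selection frames such that the set of theorems of $\mathsf{QC2}$ equals the set of $\mathcal{L}$-formulas valid in every frame of $\mathcal{C}$.
   Context: The language $\mathcal{L}$: countably many variables, for each $n$ countably many $n$-place predicates, formulas $\phi ::= P^n(x_1,\dots,x_n)\mid\neg\phi\mid(\phi\supset\phi)\mid(\phi>\phi)\mid\forall x\phi$; $\wedge,\vee,\equiv,\top,\bot,\exists$ defined as usual; $\Box\phi:=(\neg\phi>\bot)$, $\Diamond\phi:=\neg(\phi>\bot)$. $\phi[y/x]$ is capture-avoiding substitution. $\mathsf{QC2}$ is the set of formulas derivable from: (A1) substitution instances of propositional tautologies; (A2) $\phi>\phi$; (A3) $((\phi>\psi)\wedge(\psi>\phi)\wedge(\phi>\chi))\supset(\psi>\chi)$; (A4) $(\phi>\psi)\supset(\phi\supset\psi)$; (A5) $(\phi>\psi)\vee(\phi>\neg\psi)$; (A6) $\forall x\phi\supset\phi[y/x]$; (A7) $\forall x(\phi>\psi)\supset(\phi>\forall x\psi)$ where $x$ is not free in $\phi$; with rules (R1) from $\phi$ and $\phi\supset\psi$ infer $\psi$; (R2) from $(\psi_1\wedge\cdots\wedge\psi_n)\supset\chi$ infer $((\phi>\psi_1)\wedge\cdots\wedge(\phi>\psi_n))\supset(\phi>\chi)$; (R3) from $\psi\supset\phi[y/x]$, where $y$ is not free in $\psi$ or $\forall x\phi$, infer $\psi\supset\forall x\phi$. A selection frame is $\langle W,R,f,D,d\rangle$ with $W\neq\varnothing$,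 $R\subseteq W\times W$, $f:\mathcal{P}(W)\times W\to\mathcal{P}(W)$ (defined on all subsets of $W$) with $f(P,w)\subseteq R(w):=\{v: wRv\}$, $D\neq\varnothing$, and $d:W\to\mathcal{P}(D)$ (possibly empty local domains). A model on it adds $I$ with $I(P^n,w)\subseteq D^n$. With assignments $g$ from variables to $D$: $w,g\Vdash P(x_1,\dots,x_n)$ iff $\langle g(x_1),\dots,g(x_n)\rangle\in I(P,w)$; $\neg,\supset$ classical; $w,g\Vdash\forall x\phi$ iff $w,g^x_a\Vdash\phi$ for all $a\in d(w)$; $w,g\Vdash\phi>\psi$ iff $f([\phi]^g,w)\subseteq[\psi]^g$ where $[\phi]^g=\{v: v,g\Vdash\phi\}$. A formula is valid in a frame if true at all worlds, under all assignments, in all models on the frame; valid in a class if valid in every frame of the class. -}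

module Defs where

open import Level using (Level; 0ℓ) renaming (suc to lsuc)
open import Data.Nat using (ℕ; zero; suc; _≡ᵇ_; _⊔_)
open import Data.Bool using (Bool; true; false; if_then_else_; not; _∧_; _∨_; T?)
open import Data.List using (List; []; _∷_; _++_; filter; foldr)
open import Data.Bool.ListAction using (any)
open import Data.Vec as Vec using (Vec)
open import Data.Product using (Σ; _×_; _,_)
open import Data.Empty using (⊥)
open import Relation.Nullary using (¬_)
open import Relation.Binary.PropositionalEquality using (_≡_)
open import Function.Bundles using (_⇔_)
open import Axiom.ExcludedMiddle using (ExcludedMiddle)

data Formula : Set where
  atom : (n i : ℕ) → Vec ℕ n → Formula
  ¬′_  : Formula → Formula
  _⊃_  : Formula → Formula → Formula
  _>_  : Formula → Formula → Formula
  ∀′   : ℕ → Formula → Formula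

infixr 5 _⊃_
infixr 6 _>_

⊤′ : Formula
⊤′ = atom 0 0 Vec.[] ⊃ atom 0 0 Vec.[]

⊥′ : Formula
⊥′ = ¬′ ⊤′

_∧′_ : Formula → Formula → Formula
φ ∧′ ψ = ¬′ (φ ⊃ ¬′ ψ)

_∨′_ : Formula → Formula → Formula
φ ∨′ ψ = (¬′ φ) ⊃ ψ

∃′ : ℕ → Formula → Formula
∃′ x φ = ¬′ (∀′ x (¬′ φ))

⋀ : Formula → List Formula → Formula
⋀ ψ [] = ψ
⋀ ψ (ψ′ ∷ ψs) = ψ ∧′ ⋀ ψ′ ψs

fv : Formula → List ℕ
fv (atom n i xs) = Vec.toList xs
fv (¬′ φ) = fv φ
fv (φ ⊃ ψ) = fv φ ++ fv ψ
fv (φ > ψ) = fv φ ++ fv ψ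
fv (∀′ x φ) = filter (λ v → T? (not (v ≡ᵇ x))) (fv φ)

isFree : ℕ → Formula → Bool
isFree x φ = any (λ v → v ≡ᵇ x) (fv φ)

maxL : List ℕ → ℕ
maxL = foldr _⊔_ 0

rename : (ℕ → ℕ) → Formula → Formula
rename σ (atom n i xs) = atom n i (Vec.map σ xs)
rename σ (¬′ φ) = ¬′ rename σ φ
rename σ (φ ⊃ ψ) = rename σ φ ⊃ rename σ ψ
rename σ (φ > ψ) = rename σ φ > rename σ ψ
rename σ (∀′ z φ) =
  let img = Data.List.map σ (fv (∀′ z φ))
      w   = if any (λ u → u ≡ᵇ z) img then suc (maxL img) else z
  in ∀′ w (rename (λ v → if v ≡ᵇ z then w else σ v) φ)
  where import Data.List

_[_/_] : Formula → ℕ → ℕ → Formula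
φ [ y / x ] = rename (λ v → if v ≡ᵇ x then y else v) φ

data PForm : Set where
  pvar : ℕ → PForm
  pneg : PForm → PForm
  pimp : PForm → PForm → PForm

peval : (ℕ → Bool) → PForm → Bool
peval v (pvar n) = v n
peval v (pneg p) = not (peval v p)
peval v (pimp p q) = not (peval v p) ∨ peval v q

Tautology : PForm → Set
Tautology p = ∀ (v : ℕ → Bool) → peval v p ≡ true

instantiate : (ℕ → Formula) → PForm → Formula
instantiate τ (pvar n) = τ n
instantiate τ (pneg p) = ¬′ instantiate τ p
instantiate τ (pimp p q) = instantiate τ p ⊃ instantiate τ q

TautInstance : Formula → Set
TautInstance φ = Σ PForm λ p → Σ (ℕ → Formula) λ τ → Tautology p × (instantiate τ p ≡ φ)

data QC2 : Formula → Set where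
  A1 : ∀ {φ} → TautInstance φ → QC2 φ
  A2 : ∀ φ → QC2 (φ > φ)
  A3 : ∀ φ ψ χ → QC2 (((φ > ψ) ∧′ ((ψ > φ) ∧′ (φ > χ))) ⊃ (ψ > χ))
  A4 : ∀ φ ψ → QC2 ((φ > ψ) ⊃ (φ ⊃ ψ))
  A5 : ∀ φ ψ → QC2 ((φ > ψ) ∨′ (φ > ¬′ ψ))
  A6 : ∀ x φ y → QC2 (∀′ x φ ⊃ (φ [ y / x ]))
  A7 : ∀ x φ ψ → isFree x φ ≡ false → QC2 (∀′ x (φ > ψ) ⊃ (φ > ∀′ x ψ))
  R1 : ∀ {φ ψ} → QC2 φ → QC2 (φ ⊃ ψ) → QC2 ψ
  R2 : ∀ φ ψ ψs χ → QC2 (⋀ ψ ψs ⊃ χ)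
     → QC2 (⋀ (φ > ψ) (Data.List.map (φ >_) ψs) ⊃ (φ > χ))
  R3 : ∀ ψ x φ y → isFree y ψ ≡ false → isFree y (∀′ x φ) ≡ false
     → QC2 (ψ ⊃ (φ [ y / x ])) → QC2 (ψ ⊃ ∀′ x φ)

-- Selection frames.  Subsets of W are predicates W → Set; the selection
-- function must respect extensional equality of subsets (so that it is
-- a function on P(W)).

record Frame : Set₁ where
  field
    W     : Set
    w₀    : W                                  -- W ≠ ∅
    R     : W → W → Set
    f     : (W → Set) → W → (W → Set)
    f-ext : ∀ (P Q : W → Set) w v → (∀ u → P u ⇔ Q u) → f P w v → f Q w v
    f⊆R   : ∀ (P : W → Set) w v → f P w v → R w v
    D     : Set
    d₀    : D                                  -- D ≠ ∅
    d     : W → D → Set                        -- local domains (maybe empty)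

Interpretation : Frame → Set₁
Interpretation F = (n i : ℕ) → Frame.W F → Vec (Frame.D F) n → Set

module _ (F : Frame) (I : Interpretation F) where
  open Frame F

  update : (ℕ → D) → ℕ → D → (ℕ → D)
  update g x a v = if v ≡ᵇ x then a else g v

  sat : W → (ℕ → D) → Formula → Set
  sat w g (atom n i xs) = I n i w (Vec.map g xs)
  sat w g (¬′ φ) = ¬ sat w g φ
  sat w g (φ ⊃ ψ) = sat w g φ → sat w g ψ
  sat w g (φ > ψ) = ∀ v → f (λ u → sat u g φ) w v → sat v g ψ
  sat w g (∀′ x φ) = ∀ a → d w a → sat w (update g x a) φ

ValidInFrame : Frame → Formula → Set₁
ValidInFrame F φ = ∀ (I : Interpretation F) w g → sat F I w g φ

ValidInClass : (Frame → Set₁) → Formula → Set₁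
ValidInClass C φ = ∀ F → C F → ValidInFrame F φ

IsLogicOf : (Frame → Set₁) → Set₁
IsLogicOf C = ∀ φ → QC2 φ ⇔ ValidInClass C φ

-- Φ is valid on each frame validating QC2: the instances of A2, A3 and A5 in propositional letters
-- make the selection function satisfy success, CSO and select at most one world, for arbitrary
-- sets of worlds. The union X of the sets P a over the witnesses a of A is then possible (CSO
-- makes ◇ monotone), so it selects a single world x; x lies in P a for some witness a, and every
-- P a ∪ P b ⊆ X containing x selects x as well.
--
-- Φ is no theorem: QC2 is sound for a model whose root selects the ≺-least worlds of the
-- ill-founded order root ≺ limit ≺ ⋯ ≺ stage 1 ≺ stage 0, each other world selecting only itself.
-- CSO at the root holds for sets having least elements, and definable sets have them, since beyond
-- a bound fixed by the assignment every stage satisfies the same formulas as limit. Letting the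
-- individual fin n be alive exactly up to stage n, every fin n witnesses A at the root while
-- P (fin n) ∪ P (fin (n + 1)) selects stage (n + 1), outside P (fin n).

{-# OPTIONS --safe #-}
module Submission where

open import Defs
open import Level using (0ℓ; lift; lower) renaming (suc to lsuc)
open import Axiom.ExcludedMiddle using (ExcludedMiddle)
open import Axiom.DoubleNegationElimination using (em⇒dne)
open import Data.Bool using (Bool; true; false; if_then_else_; not; T; T?)
open import Data.Bool.Properties using (T-≡)
open import Data.Bool.ListAction using (any)
open import Data.Empty using (⊥; ⊥-elim)
open import Data.List using (List; []; _∷_; _++_; map)
open import Data.List.Membership.Propositional using (_∈_)
open import Data.List.Membership.Propositional.Properties
  using (∈-++⁺ˡ; ∈-++⁺ʳ; ∈-filter⁺; ∈-map⁺)
open import Data.List.Relation.Unary.Any using (here; there)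
open import Data.Nat using (ℕ; zero; suc; _≡ᵇ_; _≤ᵇ_; _≤_; _<_; z≤n; s≤s)
open import Data.Nat.Properties
  using (_≟_; ≡⇒≡ᵇ; ≤ᵇ⇒≤; ≤⇒≤ᵇ; ≤ᵇ-reflects-≤; ≤-refl; ≤-<-trans; <-trans; <-cmp;
         ≤∧≢⇒<; <⇒≱; 1+n≰n; n<1+n; m≤m⊔n; m≤n⇒m≤o⊔n)
open import Data.Product using (∃; _×_; _,_; proj₁; proj₂)
open import Data.Sum using (_⊎_; inj₁; inj₂)
open import Data.Unit using (⊤; tt)
open import Data.Vec using (Vec; []; _∷_; toList) renaming (map to mapᵥ)
open import Data.Vec.Properties using (map-∘)
open import Data.Vec.Relation.Unary.All using (All; []; _∷_)
open import Function using (_∘_; id)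
open import Function.Bundles using (_⇔_; mk⇔; Equivalence)
open import Function.Construct.Identity using (⇔-id)
open import Function.Properties.Equivalence using () renaming (sym to ⇔-sym; trans to ⇔-trans)
open import Function.Related.TypeIsomorphisms using (→-cong-⇔; ¬-cong-⇔)
open import Relation.Binary.Definitions using (tri<; tri≈; tri>)
open import Relation.Binary.PropositionalEquality using (_≡_; refl; sym; cong; cong₂; subst)
open import Relation.Nullary using (¬_; yes; no; contradiction)
open import Relation.Nullary.Decidable using (map′; does; proof)
open import Relation.Nullary.Reflects using (Reflects; ofⁿ; ¬-reflects; _→-reflects_; invert; det)
open import Relation.Unary using (Pred; _⊆′_; ∁; _⇒_; ∅; Empty; Decidable; ｛_｝; _∩_)

open Equivalence using (to; from)

×⇒¬→¬ : {A B : Set} → A × B → ¬ (A → ¬ B)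
×⇒¬→¬ (a , b) k = k a b

≡⇒⇔ : {A B : Set} → A ≡ B → A ⇔ B
≡⇒⇔ refl = ⇔-id _

module Classical (em : ExcludedMiddle 0ℓ) where

  dne : {A : Set} → ¬ ¬ A → A
  dne = em⇒dne em

  ¬→¬⇒× : {A B : Set} → ¬ (A → ¬ B) → A × B
  ¬→¬⇒× k = dne (λ ¬a → k (λ a → contradiction a ¬a)) , dne (λ ¬b → k (λ _ → ¬b))

  ¬∀¬⇒∃ : {A : Set} {P : A → Set} → ¬ (∀ a → ¬ P a) → ∃ P
  ¬∀¬⇒∃ k = dne (λ ∄ → k (λ a Pa → ∄ (a , Pa)))

  ¬∀→¬⇒∃× : {A : Set} {P Q : A → Set} → ¬ (∀ a → P a → ¬ Q a) → ∃ λ a → P a × Q a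
  ¬∀→¬⇒∃× k = ¬∀¬⇒∃ (λ ∄ → k (λ a Pa Qa → ∄ a (Pa , Qa)))

bounded-greatest : {P : Pred ℕ 0ℓ} → Decidable P → ∀ N {n} → P n → (∀ k → N ≤ k → ¬ P k) →
                   ∃ λ m → P m × (∀ k → m < k → ¬ P k)
bounded-greatest P? zero Pn none = contradiction Pn (none _ z≤n)
bounded-greatest {P} P? (suc N) Pn none with P? N
... | yes PN = N , PN , none
... | no ¬PN = bounded-greatest P? N Pn none-from-N
  where
  none-from-N : ∀ k → N ≤ k → ¬ P k
  none-from-N k N≤k with N ≟ k
  ... | yes refl = ¬PN
  ... | no N≢k = none k (≤∧≢⇒< N≤k N≢k)

∈⇒≤maxL : ∀ {u xs} → u ∈ xs → u ≤ maxL xs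
∈⇒≤maxL {xs = x ∷ xs} (here refl) = m≤m⊔n x (maxL xs)
∈⇒≤maxL {xs = x ∷ xs} (there u∈) = m≤n⇒m≤o⊔n x (∈⇒≤maxL u∈)

≤⇒≡ᵇsuc≡false : ∀ {m n} → m ≤ n → (m ≡ᵇ suc n) ≡ false
≤⇒≡ᵇsuc≡false z≤n = refl
≤⇒≡ᵇsuc≡false (s≤s m≤n) = ≤⇒≡ᵇsuc≡false m≤n

any-false : ∀ {p : ℕ → Bool} xs {u} → any p xs ≡ false → u ∈ xs → p u ≡ false
any-false {p} (x ∷ xs) none u∈ with p x in px
any-false {p} (x ∷ xs) () u∈ | true
any-false {p} (x ∷ xs) none (here refl) | false = px
any-false {p} (x ∷ xs) none (there u∈) | false = any-false xs none u∈

∈-fv-∀′ : ∀ {v} x φ → v ∈ fv φ → (v ≡ᵇ x) ≡ false → v ∈ fv (∀′ x φ)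
∈-fv-∀′ x φ v∈ v≢x = ∈-filter⁺ (λ u → T? (not (u ≡ᵇ x))) v∈ (subst (T ∘ not) (sym v≢x) tt)

AgreeOn : {B : Set} → List ℕ → (ℕ → B) → (ℕ → B) → Set
AgreeOn xs g h = ∀ v → v ∈ xs → g v ≡ h v

module _ {B : Set} {g h : ℕ → B} where

  agree-++ˡ : ∀ {xs ys} → AgreeOn (xs ++ ys) g h → AgreeOn xs g h
  agree-++ˡ e v v∈ = e v (∈-++⁺ˡ v∈)

  agree-++ʳ : ∀ xs {ys} → AgreeOn (xs ++ ys) g h → AgreeOn ys g h
  agree-++ʳ xs e v v∈ = e v (∈-++⁺ʳ xs v∈)

  map-agree : ∀ {n} (xs : Vec ℕ n) → AgreeOn (toList xs) g h → mapᵥ g xs ≡ mapᵥ h xs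
  map-agree [] e = refl
  map-agree (x ∷ xs) e = cong₂ _∷_ (e x (here refl)) (map-agree xs (λ v v∈ → e v (there v∈)))

module Model (F : Frame) (I : Interpretation F) where
  open Frame F

  ⟦_⟧ : Formula → (ℕ → D) → Pred W 0ℓ
  ⟦ φ ⟧ g w = sat F I w g φ

  _[_↦_] : (ℕ → D) → ℕ → D → (ℕ → D)
  g [ x ↦ a ] = update F I g x a

  update-self : ∀ g x a → (g [ x ↦ a ]) x ≡ a
  update-self g x a = cong (if_then a else g x) (to T-≡ (≡⇒≡ᵇ x x refl))

  update-other : ∀ g x {a} v → (v ≡ᵇ x) ≡ false → (g [ x ↦ a ]) v ≡ g v
  update-other g x {a} v v≢x = cong (if_then a else g v) v≢x

  agree-update-not-free : ∀ x φ {g a} → isFree x φ ≡ false → AgreeOn (fv φ) g (g [ x ↦ a ])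
  agree-update-not-free x φ {g} x∉φ v v∈ = sym (update-other g x v (any-false (fv φ) x∉φ v∈))

  >-cong : ∀ {A A′ B B′ : Pred W 0ℓ} {w} → (∀ u → A u ⇔ A′ u) → (∀ u → B u ⇔ B′ u) →
           (f A w ⊆′ B) ⇔ (f A′ w ⊆′ B′)
  >-cong {A} {A′} {w = w} A⇔A′ B⇔B′ = mk⇔
    (λ A>B v sel → to (B⇔B′ v) (A>B v (f-ext A′ A w v (⇔-sym ∘ A⇔A′) sel)))
    (λ A′>B′ v sel → from (B⇔B′ v) (A′>B′ v (f-ext A A′ w v A⇔A′ sel)))

  ∀-cong : ∀ {S S′ : D → Set} {w} → (∀ a → S a ⇔ S′ a) →
           (∀ a → d w a → S a) ⇔ (∀ a → d w a → S′ a)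
  ∀-cong S⇔S′ = mk⇔ (λ s a da → to (S⇔S′ a) (s a da)) (λ s a da → from (S⇔S′ a) (s a da))

  coincidence : ∀ φ {w g h} → AgreeOn (fv φ) g h → ⟦ φ ⟧ g w ⇔ ⟦ φ ⟧ h w
  coincidence (atom n i xs) {w} e = ≡⇒⇔ (cong (I n i w) (map-agree xs e))
  coincidence (¬′ φ) e = ¬-cong-⇔ (coincidence φ e)
  coincidence (φ ⊃ ψ) e =
    →-cong-⇔ (coincidence φ (agree-++ˡ e)) (coincidence ψ (agree-++ʳ (fv φ) e))
  coincidence (φ > ψ) e =
    >-cong (λ _ → coincidence φ (agree-++ˡ e)) (λ _ → coincidence ψ (agree-++ʳ (fv φ) e))
  coincidence (∀′ x φ) {g = g} {h} e = ∀-cong (λ a → coincidence φ (agree-under a))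
    where
    agree-under : ∀ a → AgreeOn (fv φ) (g [ x ↦ a ]) (h [ x ↦ a ])
    agree-under a v v∈ with v ≡ᵇ x in v≢x
    ... | true = refl
    ... | false = e v (∈-fv-∀′ x φ v∈ v≢x)

  renamed-binder : (ℕ → ℕ) → ℕ → Formula → ℕ
  renamed-binder σ z φ =
    if any (λ u → u ≡ᵇ z) (map σ (fv (∀′ z φ))) then suc (maxL (map σ (fv (∀′ z φ)))) else z

  renamed-binder-fresh : ∀ σ z φ v → v ∈ fv (∀′ z φ) → (σ v ≡ᵇ renamed-binder σ z φ) ≡ false
  renamed-binder-fresh σ z φ v v∈ with any (λ u → u ≡ᵇ z) (map σ (fv (∀′ z φ))) in clash
  ... | true = ≤⇒≡ᵇsuc≡false (∈⇒≤maxL (∈-map⁺ σ v∈))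
  ... | false = any-false (map σ (fv (∀′ z φ))) clash (∈-map⁺ σ v∈)

  rename-∀ : ∀ z φ σ z′ → (∀ v → v ∈ fv (∀′ z φ) → (σ v ≡ᵇ z′) ≡ false) →
             (∀ σ′ {w g} → ⟦ rename σ′ φ ⟧ g w ⇔ ⟦ φ ⟧ (g ∘ σ′) w) →
             ∀ {w g} → ⟦ ∀′ z′ (rename (λ v → if v ≡ᵇ z then z′ else σ v) φ) ⟧ g w
                     ⇔ ⟦ ∀′ z φ ⟧ (g ∘ σ) w
  rename-∀ z φ σ z′ fresh rename-φ {g = g} =
    ∀-cong (λ a → ⇔-trans (rename-φ _) (coincidence φ (agree a)))
    where
    agree : ∀ a → AgreeOn (fv φ) ((g [ z′ ↦ a ]) ∘ (λ v → if v ≡ᵇ z then z′ else σ v))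
                               ((g ∘ σ) [ z ↦ a ])
    agree a v v∈ with v ≡ᵇ z in v≢z
    ... | true = update-self g z′ a
    ... | false = update-other g z′ (σ v) (fresh v (∈-fv-∀′ z φ v∈ v≢z))

  sat-rename : ∀ φ σ {w g} → ⟦ rename σ φ ⟧ g w ⇔ ⟦ φ ⟧ (g ∘ σ) w
  sat-rename (atom n i xs) σ {w} {g} = ≡⇒⇔ (cong (I n i w) (sym (map-∘ g σ xs)))
  sat-rename (¬′ φ) σ = ¬-cong-⇔ (sat-rename φ σ)
  sat-rename (φ ⊃ ψ) σ = →-cong-⇔ (sat-rename φ σ) (sat-rename ψ σ)
  sat-rename (φ > ψ) σ = >-cong (λ _ → sat-rename φ σ) (λ _ → sat-rename ψ σ)
  sat-rename (∀′ z φ) σ =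
    rename-∀ z φ σ (renamed-binder σ z φ) (renamed-binder-fresh σ z φ) (sat-rename φ)

  module _ (em : ExcludedMiddle 0ℓ) where
    open Classical em

    tautology-valid : ∀ {φ} → TautInstance φ → ∀ w g → ⟦ φ ⟧ g w
    tautology-valid (p , τ , tautology , refl) w g =
      invert (subst (Reflects _) (tautology value) (reflects p))
      where
      value : ℕ → Bool
      value n = does (em {⟦ τ n ⟧ g w})
      reflects : ∀ p → Reflects (⟦ instantiate τ p ⟧ g w) (peval value p)
      reflects (pvar n) = proof em
      reflects (pneg p) = ¬-reflects (reflects p)
      reflects (pimp p q) = reflects p →-reflects reflects q

    ⋀-conditionals : ∀ φ ψ ψs {w g} → ⟦ ⋀ (φ > ψ) (map (φ >_) ψs) ⟧ g w →
                     f (⟦ φ ⟧ g) w ⊆′ ⟦ ⋀ ψ ψs ⟧ g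
    ⋀-conditionals φ ψ [] φ>ψ = φ>ψ
    ⋀-conditionals φ ψ (ψ′ ∷ ψs) conditionals v sel =
      let (φ>ψ , φ>rest) = ¬→¬⇒× conditionals
      in ×⇒¬→¬ (φ>ψ v sel , ⋀-conditionals φ ψ′ ψs φ>rest v sel)

record QC2Conditions (F : Frame) (I : Interpretation F) : Set₁ where
  open Frame F
  open Model F I
  field
    total-domain : ∀ w a → d w a
    success      : ∀ A w → f A w ⊆′ A
    centred      : ∀ A w → A w → f A w w
    functional   : ∀ A w {v v′} → f A w v → f A w v′ → v ≡ v′
    -- CSO only for definable antecedents, which is all that A3 needs.
    cso          : ∀ φ g (B C : Pred W 0ℓ) w →
                   f (⟦ φ ⟧ g) w ⊆′ B → f B w ⊆′ ⟦ φ ⟧ g → f (⟦ φ ⟧ g) w ⊆′ C → f B w ⊆′ C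

module Soundness (em : ExcludedMiddle 0ℓ) {F : Frame} {I : Interpretation F}
                 (M : QC2Conditions F I) where
  open Frame F
  open Model F I
  open QC2Conditions M
  open Classical em

  sound : ∀ {φ} → QC2 φ → ∀ w g → ⟦ φ ⟧ g w
  sound (A1 t) = tautology-valid em t
  sound (A2 φ) w g = success _ w
  sound (A3 φ ψ χ) w g premises =
    let (φ>ψ , rest) = ¬→¬⇒× premises
        (ψ>φ , φ>χ) = ¬→¬⇒× rest
    in cso φ g _ _ w φ>ψ ψ>φ φ>χ
  sound (A4 φ ψ) w g φ>ψ φw = φ>ψ w (centred _ w φw)
  sound (A5 φ ψ) w g ¬φ>ψ v sel ψv =
    ¬φ>ψ (λ v′ sel′ → subst (⟦ ψ ⟧ g) (functional _ w sel sel′) ψv)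
  sound (A6 x φ y) w g ∀φ =
    from (sat-rename φ _) (to (coincidence φ agree) (∀φ (g y) (total-domain w (g y))))
    where
    agree : AgreeOn (fv φ) (g [ x ↦ g y ]) (g ∘ (λ v → if v ≡ᵇ x then y else v))
    agree v _ with v ≡ᵇ x
    ... | true = refl
    ... | false = refl
  sound (A7 x φ ψ x∉φ) w g ∀φ>ψ v sel a _ =
    ∀φ>ψ a (total-domain w a) v
      (f-ext _ _ w v (λ _ → coincidence φ (agree-update-not-free x φ x∉φ)) sel)
  sound (R1 ⊢φ ⊢φ⊃ψ) w g = sound ⊢φ⊃ψ w g (sound ⊢φ w g)
  sound (R2 φ ψ ψs χ ⊢⋀⊃χ) w g conditionals v sel =
    sound ⊢⋀⊃χ v g (⋀-conditionals em φ ψ ψs conditionals v sel)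
  sound (R3 ψ x φ y y∉ψ y∉∀φ ⊢ψ⊃φ[y/x]) w g ψw a _ =
    to (coincidence φ agree) (to (sat-rename φ _)
      (sound ⊢ψ⊃φ[y/x] w (g [ y ↦ a ]) (to (coincidence ψ (agree-update-not-free y ψ y∉ψ)) ψw)))
    where
    agree : AgreeOn (fv φ) ((g [ y ↦ a ]) ∘ (λ v → if v ≡ᵇ x then y else v)) (g [ x ↦ a ])
    agree v v∈ with v ≡ᵇ x in v≢x
    ... | true = update-self g y a
    ... | false = update-other g y v (any-false (fv (∀′ x φ)) y∉∀φ (∈-fv-∀′ x φ v∈ v≢x))

P[_] Q[_] : ℕ → Formula
P[ x ] = atom 1 0 (x ∷ [])
Q[ x ] = atom 1 1 (x ∷ [])

◇′ : Formula → Formula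
◇′ φ = ¬′ (φ > ⊥′)

A[_] : ℕ → Formula
A[ x ] = Q[ x ] ∧′ ◇′ P[ x ]

Φ : Formula
Φ = ∃′ 0 A[ 0 ] ⊃ ∃′ 0 (A[ 0 ] ∧′ ∀′ 1 (A[ 1 ] ⊃ ((P[ 0 ] ∨′ P[ 1 ]) > P[ 0 ])))

module Correspondence (em : ExcludedMiddle 0ℓ) (F : Frame)
                      (QC2-valid : ∀ φ → QC2 φ → ValidInFrame F φ) where
  open Frame F
  open Classical em

  private
    letters : (A B C : Pred W 0ℓ) → Interpretation F
    letters A B C 0 0 u _ = A u
    letters A B C 0 1 u _ = B u
    letters A B C _ _ u _ = C u

    p q r : Formula
    p = atom 0 0 []
    q = atom 0 1 []
    r = atom 0 2 []

    valid-for : ∀ {φ} → QC2 φ → (A B C : Pred W 0ℓ) → ∀ w → sat F (letters A B C) w (λ _ → d₀) φ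
    valid-for ⊢φ A B C w = QC2-valid _ ⊢φ (letters A B C) w (λ _ → d₀)

  f-success : ∀ A w → f A w ⊆′ A
  f-success A w = valid-for (A2 p) A A A w

  f-cso : ∀ A B C w → f A w ⊆′ B → f B w ⊆′ A → f A w ⊆′ C → f B w ⊆′ C
  f-cso A B C w A>B B>A A>C = valid-for (A3 p q r) A B C w (×⇒¬→¬ (A>B , ×⇒¬→¬ (B>A , A>C)))

  f-cem : ∀ A B w → ¬ (f A w ⊆′ B) → f A w ⊆′ ∁ B
  f-cem A B w = valid-for (A5 p q) A B B w

  f-functional : ∀ A w {v v′} → f A w v → f A w v′ → v ≡ v′
  f-functional A w {v} {v′} sel sel′ =
    dne (λ v≢v′ → f-cem A ｛ v ｝ w (λ A>v → v≢v′ (A>v v′ sel′)) v sel refl)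

  possible-mono : ∀ A B w → A ⊆′ B → ¬ Empty (f A w) → ¬ Empty (f B w)
  possible-mono A B w A⊆B possible-A impossible-B = possible-A (f-cso B A ∅ w
    (λ v sel → ⊥-elim (impossible-B v sel))
    (λ v sel → A⊆B v (f-success A w v sel))
    impossible-B)

  selection-inherited : ∀ X B w x → f X w x → B ⊆′ X → B x → f B w ⊆′ ｛ x ｝
  selection-inherited X B w x x-selected B⊆X Bx = f-cso X B ｛ x ｝ w
    (λ v sel → subst B (f-functional X w x-selected sel) Bx)
    (λ v sel → B⊆X v (f-success B w v sel))
    (λ v sel → f-functional X w x-selected sel)

  dominant-witness : ∀ w (P : D → Pred W 0ℓ) (Good : Pred D 0ℓ) →
                     (∀ a → Good a → ¬ Empty (f (P a) w)) → ∀ a₀ → Good a₀ →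
                     ∃ λ a → Good a × (∀ b → Good b → f (∁ (P a) ⇒ P b) w ⊆′ P a)
  dominant-witness w P Good possible a₀ good₀ =
    let (x , x-selected) = ¬∀¬⇒∃ (possible-mono (P a₀) X w (λ u Pu → a₀ , good₀ , Pu)
                                                (possible a₀ good₀))
        (a , good , Pax) = f-success X w x x-selected
        only-x : ∀ {b} → Good b → f (∁ (P a) ⇒ P b) w ⊆′ ｛ x ｝
        only-x good′ = selection-inherited X _ w x x-selected (∁P⇒P⊆X good good′) (contradiction Pax)
    in a , good , λ b good′ v sel → subst (P a) (only-x good′ v sel) Pax
    where
    X : Pred W 0ℓ
    X u = ∃ λ a → Good a × P a u
    ∁P⇒P⊆X : ∀ {a b} → Good a → Good b → (∁ (P a) ⇒ P b) ⊆′ X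
    ∁P⇒P⊆X {a} {b} good good′ u Pa∨Pb with em {P a u}
    ... | yes Pau = a , good , Pau
    ... | no ¬Pau = b , good′ , Pa∨Pb ¬Pau

  Φ-valid : ValidInFrame F Φ
  Φ-valid I w g some-A =
    let (a₀ , good₀) = ¬∀→¬⇒∃× some-A
        (a , (da , Aa) , maximal) = dominant-witness w P Good possible a₀ good₀
    in λ none → none a da (×⇒¬→¬ (Aa , λ b db Ab → maximal b (db , Ab)))
    where
    open Model F I using (⟦_⟧; _[_↦_])
    P : D → Pred W 0ℓ
    P a u = I 1 0 u (a ∷ [])
    Good : Pred D 0ℓ
    Good a = d w a × ⟦ A[ 0 ] ⟧ (g [ 0 ↦ a ]) w
    possible : ∀ a → Good a → ¬ Empty (f (P a) w)
    possible a (_ , Aa) impossible = proj₂ (¬→¬⇒× Aa) (λ v sel → ⊥-elim (impossible v sel))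

module Minimal {A : Set} (_≺_ : A → A → Set) (≺-trans : ∀ {a b c} → a ≺ b → b ≺ c → a ≺ c)
               (compare : ∀ a b → a ≡ b ⊎ a ≺ b ⊎ b ≺ a) where

  Minimal : Pred A 0ℓ → Pred A 0ℓ
  Minimal S a = S a × (∀ b → b ≺ a → ¬ S b)

  minimal-unique : ∀ {S a a′} → Minimal S a → Minimal S a′ → a ≡ a′
  minimal-unique {a = a} {a′} (Sa , min) (Sa′ , min′) with compare a a′
  ... | inj₁ a≡a′ = a≡a′
  ... | inj₂ (inj₁ a≺a′) = contradiction Sa (min′ a a≺a′)
  ... | inj₂ (inj₂ a′≺a) = contradiction Sa′ (min a′ a′≺a)

  minimal-cso : ∀ (S T C : Pred A 0ℓ) → (∀ a → S a → ∃ (Minimal S)) →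
                Minimal S ⊆′ T → Minimal T ⊆′ S → Minimal S ⊆′ C → Minimal T ⊆′ C
  minimal-cso S T C has-minimal S⊆T T⊆S S⊆C a a-min@(_ , min-T) = S⊆C a (T⊆S a a-min , no-S-below)
    where
    no-S-below : ∀ b → b ≺ a → ¬ S b
    no-S-below b b≺a Sb with has-minimal b Sb
    ... | m , m-min@(_ , min-S) with compare m b
    ...   | inj₁ refl = min-T m b≺a (S⊆T m m-min)
    ...   | inj₂ (inj₁ m≺b) = min-T m (≺-trans m≺b b≺a) (S⊆T m m-min)
    ...   | inj₂ (inj₂ b≺m) = min-S b b≺m Sb

module Countermodel where

  data Leaf : Set where
    limit : Leaf
    stage : ℕ → Leaf

  data World : Set where
    root : World
    leaf : Leaf → World

  data _≺_ : World → World → Set where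
    root≺leaf   : ∀ {l} → root ≺ leaf l
    limit≺stage : ∀ {n} → leaf limit ≺ leaf (stage n)
    stage≺stage : ∀ {m n} → m < n → leaf (stage n) ≺ leaf (stage m)

  ≺-trans : ∀ {u v w} → u ≺ v → v ≺ w → u ≺ w
  ≺-trans root≺leaf limit≺stage = root≺leaf
  ≺-trans root≺leaf (stage≺stage _) = root≺leaf
  ≺-trans limit≺stage (stage≺stage _) = limit≺stage
  ≺-trans (stage≺stage m<n) (stage≺stage k<m) = stage≺stage (<-trans k<m m<n)

  ≺-compare : ∀ u v → u ≡ v ⊎ u ≺ v ⊎ v ≺ u
  ≺-compare root root = inj₁ refl
  ≺-compare root (leaf _) = inj₂ (inj₁ root≺leaf)
  ≺-compare (leaf _) root = inj₂ (inj₂ root≺leaf)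
  ≺-compare (leaf limit) (leaf limit) = inj₁ refl
  ≺-compare (leaf limit) (leaf (stage _)) = inj₂ (inj₁ limit≺stage)
  ≺-compare (leaf (stage _)) (leaf limit) = inj₂ (inj₂ limit≺stage)
  ≺-compare (leaf (stage m)) (leaf (stage n)) with <-cmp m n
  ... | tri< m<n _ _ = inj₂ (inj₂ (stage≺stage m<n))
  ... | tri≈ _ refl _ = inj₁ refl
  ... | tri> _ _ n<m = inj₂ (inj₁ (stage≺stage n<m))

  open Minimal _≺_ ≺-trans ≺-compare

  select : Pred World 0ℓ → World → Pred World 0ℓ
  select S root = Minimal S
  select S (leaf l) = ｛ leaf l ｝ ∩ S

  select-ext : ∀ (S S′ : Pred World 0ℓ) w v → (∀ u → S u ⇔ S′ u) → select S w v → select S′ w v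
  select-ext S S′ root v S⇔S′ (Sv , min) =
    to (S⇔S′ v) Sv , λ u u≺v S′u → min u u≺v (from (S⇔S′ u) S′u)
  select-ext S S′ (leaf l) v S⇔S′ (l≡v , Sv) = l≡v , to (S⇔S′ v) Sv

  select-⊆ : ∀ S w → select S w ⊆′ S
  select-⊆ S root v (Sv , _) = Sv
  select-⊆ S (leaf l) v (refl , Sv) = Sv

  select-centred : ∀ S w → S w → select S w w
  select-centred S root Sr = Sr , λ _ ()
  select-centred S (leaf l) Sl = refl , Sl

  select-functional : ∀ S w {v v′} → select S w v → select S w v′ → v ≡ v′
  select-functional S root = minimal-unique
  select-functional S (leaf l) (refl , _) (refl , _) = refl

  leaf-conditional : ∀ (S T : Pred World 0ℓ) l →
                     (select S (leaf l) ⊆′ T) ⇔ (S (leaf l) → T (leaf l))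
  leaf-conditional S T l =
    mk⇔ (λ S>T Sl → S>T (leaf l) (refl , Sl)) (λ { S⇒T _ (refl , Sl) → S⇒T Sl })

  data Individual : Set where
    fin : ℕ → Individual
    ∞   : Individual

  alive : Individual → Leaf → Bool
  alive ∞ _ = true
  alive (fin n) limit = false
  alive (fin n) (stage k) = k ≤ᵇ n

  frame : Frame
  frame = record
    { W = World ; w₀ = root ; R = λ _ _ → ⊤ ; f = select ; f-ext = select-ext ; f⊆R = λ _ _ _ _ → tt
    ; D = Individual ; d₀ = ∞ ; d = λ _ _ → ⊤ }

  interp : Interpretation frame
  interp _ _ (leaf l) as = All (λ a → T (alive a l)) as
  interp 1 1 root (fin _ ∷ []) = ⊤
  interp _ _ root _ = ⊥

  open Model frame interp

  AliveOnto : Leaf → Set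
  AliveOnto l = ∀ b → ∃ λ a → alive a l ≡ b

  limit-onto : AliveOnto limit
  limit-onto true = ∞ , refl
  limit-onto false = fin 0 , refl

  stage-onto : ∀ k → AliveOnto (stage (suc k))
  stage-onto k true = ∞ , refl
  stage-onto k false = fin 0 , refl

  alive-transfer : ∀ {n l l′ g h} (xs : Vec ℕ n) →
                   AgreeOn (toList xs) (λ v → alive (g v) l) (λ v → alive (h v) l′) →
                   All (λ a → T (alive a l)) (mapᵥ g xs) → All (λ a → T (alive a l′)) (mapᵥ h xs)
  alive-transfer [] e [] = []
  alive-transfer (x ∷ xs) e (px ∷ pxs) =
    subst T (e x (here refl)) px ∷ alive-transfer xs (λ v v∈ → e v (there v∈)) pxs

  leaf-bisimilar : ∀ φ {l l′ g h} → AliveOnto l → AliveOnto l′ →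
                   AgreeOn (fv φ) (λ v → alive (g v) l) (λ v → alive (h v) l′) →
                   ⟦ φ ⟧ g (leaf l) ⇔ ⟦ φ ⟧ h (leaf l′)
  leaf-bisimilar (atom n i xs) _ _ e =
    mk⇔ (alive-transfer xs e) (alive-transfer xs (λ v v∈ → sym (e v v∈)))
  leaf-bisimilar (¬′ φ) onto onto′ e = ¬-cong-⇔ (leaf-bisimilar φ onto onto′ e)
  leaf-bisimilar (φ ⊃ ψ) onto onto′ e =
    →-cong-⇔ (leaf-bisimilar φ onto onto′ (agree-++ˡ e))
             (leaf-bisimilar ψ onto onto′ (agree-++ʳ (fv φ) e))
  leaf-bisimilar (φ > ψ) {l} {l′} onto onto′ e =
    ⇔-trans (leaf-conditional _ _ l)
      (⇔-trans (→-cong-⇔ (leaf-bisimilar φ onto onto′ (agree-++ˡ e))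
                          (leaf-bisimilar ψ onto onto′ (agree-++ʳ (fv φ) e)))
               (⇔-sym (leaf-conditional _ _ l′)))
  leaf-bisimilar (∀′ x φ) {l} {l′} {g} {h} onto onto′ e = mk⇔
    (λ ∀φ b _ → let (a , a~b) = onto (alive b l′)
                in to (leaf-bisimilar φ onto onto′ (agree a b a~b)) (∀φ a tt))
    (λ ∀φ a _ → let (b , b~a) = onto′ (alive a l)
                in from (leaf-bisimilar φ onto onto′ (agree a b (sym b~a))) (∀φ b tt))
    where
    agree : ∀ a b → alive a l ≡ alive b l′ →
            AgreeOn (fv φ) (λ v → alive ((g [ x ↦ a ]) v) l) (λ v → alive ((h [ x ↦ b ]) v) l′)
    agree a b a~b v v∈ with v ≡ᵇ x in v≢x
    ... | true = a~b
    ... | false = e v (∈-fv-∀′ x φ v∈ v≢x)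

  index : Individual → ℕ
  index (fin n) = n
  index ∞ = 0

  bound : Formula → (ℕ → Individual) → ℕ
  bound φ g = maxL (map (index ∘ g) (fv φ))

  alive-late : ∀ a k → index a < k → alive a (stage k) ≡ alive a limit
  alive-late ∞ k _ = refl
  alive-late (fin n) k n<k = det (≤ᵇ-reflects-≤ k n) (ofⁿ (<⇒≱ n<k))

  stage≈limit : ∀ φ g k → bound φ g < k → ⟦ φ ⟧ g (leaf (stage k)) ⇔ ⟦ φ ⟧ g (leaf limit)
  stage≈limit φ g (suc k) bound<k = leaf-bisimilar φ (stage-onto k) limit-onto
    (λ v v∈ → alive-late (g v) (suc k) (≤-<-trans (∈⇒≤maxL (∈-map⁺ (index ∘ g) v∈)) bound<k))

  module _ (em : ExcludedMiddle 0ℓ) where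

    definable-minimal : ∀ φ g u → ⟦ φ ⟧ g u → ∃ (Minimal (⟦ φ ⟧ g))
    definable-minimal φ g u φu with em {⟦ φ ⟧ g root} | em {⟦ φ ⟧ g (leaf limit)}
    ... | yes φ-root | _ = root , φ-root , λ _ ()
    ... | no ¬φ-root | yes φ-limit = leaf limit , φ-limit , λ { root _ → ¬φ-root ; (leaf _) () }
    ... | no ¬φ-root | no ¬φ-limit = latest u φu
      where
      latest : ∀ u → ⟦ φ ⟧ g u → ∃ (Minimal (⟦ φ ⟧ g))
      latest root φ-root = contradiction φ-root ¬φ-root
      latest (leaf limit) φ-limit = contradiction φ-limit ¬φ-limit
      latest (leaf (stage n)) φn =
        let (m , φm , none-later) =
              bounded-greatest (λ _ → em) (suc (bound φ g)) φn
                (λ k bound<k φk → ¬φ-limit (to (stage≈limit φ g k bound<k) φk))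
        in leaf (stage m) , φm , λ { root _ → ¬φ-root
                                   ; (leaf limit) _ → ¬φ-limit
                                   ; (leaf (stage k)) (stage≺stage m<k) → none-later k m<k }

    select-cso : ∀ φ g (B C : Pred World 0ℓ) w →
                 select (⟦ φ ⟧ g) w ⊆′ B → select B w ⊆′ ⟦ φ ⟧ g → select (⟦ φ ⟧ g) w ⊆′ C →
                 select B w ⊆′ C
    select-cso φ g B C root = minimal-cso (⟦ φ ⟧ g) B C (definable-minimal φ g)
    select-cso φ g B C (leaf l) _ B>φ φ>C v (refl , Bl) =
      φ>C (leaf l) (refl , B>φ (leaf l) (refl , Bl))

    conditions : QC2Conditions frame interp
    conditions = record
      { total-domain = λ _ _ → tt
      ; success      = select-⊆
      ; centred      = select-centred
      ; functional   = select-functional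
      ; cso          = select-cso
      }

  P-at : Individual → Pred World 0ℓ
  P-at a u = interp 1 0 u (a ∷ [])

  P-at-stage : ∀ {n k} → P-at (fin n) (leaf (stage k)) → k ≤ n
  P-at-stage {n} {k} (k≤n ∷ []) = ≤ᵇ⇒≤ k n k≤n

  stage-minimal : ∀ n → Minimal (P-at (fin n)) (leaf (stage n))
  stage-minimal n = ≤⇒≤ᵇ (≤-refl {n}) ∷ [] , earlier
    where
    earlier : ∀ u → u ≺ leaf (stage n) → ¬ P-at (fin n) u
    earlier root _ ()
    earlier (leaf limit) _ (() ∷ [])
    earlier (leaf (stage k)) (stage≺stage n<k) Pk = <⇒≱ n<k (P-at-stage Pk)

  next-stage-minimal : ∀ n → Minimal (∁ (P-at (fin n)) ⇒ P-at (fin (suc n))) (leaf (stage (suc n)))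
  next-stage-minimal n = (λ _ → proj₁ (stage-minimal (suc n))) , λ u u≺ Pn∨Psn →
    proj₂ (stage-minimal (suc n)) u u≺
      (Pn∨Psn (proj₂ (stage-minimal n) u (≺-trans u≺ (stage≺stage (n<1+n n)))))

  Φ-fails : ∀ g → ¬ ⟦ Φ ⟧ g root
  Φ-fails g Φ-holds = Φ-holds (λ none → none (fin 0) tt (A-fin 0)) (λ a _ → no-maximal a)
    where
    A-fin : ∀ n → ⟦ A[ 0 ] ⟧ (g [ 0 ↦ fin n ]) root
    A-fin n = ×⇒¬→¬ (tt , λ □¬P → □¬P (leaf (stage n)) (stage-minimal n) id)
    no-maximal : ∀ a →
                 ¬ ⟦ A[ 0 ] ∧′ ∀′ 1 (A[ 1 ] ⊃ ((P[ 0 ] ∨′ P[ 1 ]) > P[ 0 ])) ⟧ (g [ 0 ↦ a ]) root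
    no-maximal ∞ Aa∧maximal = Aa∧maximal (λ A∞ _ → A∞ (λ ()))
    no-maximal (fin n) Aa∧maximal = Aa∧maximal λ _ maximal → 1+n≰n (P-at-stage
      (maximal (fin (suc n)) tt (A-fin (suc n)) (leaf (stage (suc n))) (next-stage-minimal n)))

theorem4p7 : ExcludedMiddle (lsuc 0ℓ) → (C : Frame → Set₁) → ¬ IsLogicOf C
theorem4p7 lem C logic-of-C = Φ-fails (λ _ → ∞) (sound ⊢Φ root (λ _ → ∞))
  where
  open Countermodel
  em : ExcludedMiddle 0ℓ
  em = map′ lower lift lem
  open Soundness em (conditions em)
  Φ-valid-in-C : ValidInClass C Φ
  Φ-valid-in-C F F∈C = Correspondence.Φ-valid em F (λ φ ⊢φ → to (logic-of-C φ) ⊢φ F F∈C)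
  ⊢Φ : QC2 Φ
  ⊢Φ = from (logic-of-C Φ) Φ-valid-in-C
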